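{- Every automatic sequence is weakly periodic.
   Context: For $k\ge2$, a sequence $(a_n)_{n\ge0}$ with values in a finite set is $k$-automatic if there exist a finite set $S$, $s_0\in S$, $\delta\colon S\times\{0,\dots,k-1\}\to S$ (extended to words by reading letters left to right) and an output map $\tau$ with $a_n=\tau(\delta(s_0,(n)_k))$, where $(n)_k$ is the base-$k$ expansion of $n$ without leading zeros; equivalently, its $k$-kernel $\{(a_{k^ln+r})_{n\ge0}:l\ge0,0\le r<k^l\}$ is finite. Automatic means $k$-automatic for some $k\ge2$. A sequence $f$ on $\mathbb{N}_0$ is weakly periodic if for every $a\in\mathbb{N}$, $b\in\mathbb{N}_0$, the sequence $f'(n)=f(an+b)$ admits $q\in\mathbb{N}$ and $r,r'\in\mathbb{N}_0$ with $r\ne r'$ such that $f'(qn+r)=f'(qn+r')$ for all $n\in\mathbb{N}_0$. -}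

module Defs where

open import Data.Nat using (ℕ; zero; suc; _+_; _*_; _≤_; NonZero)
open import Data.Nat.DivMod using (_/_; _%_)
open import Data.Fin using (Fin; fromℕ<)
open import Data.Nat.DivMod using (m%n<n)
open import Data.List using (List; []; _∷_; _++_; foldl)
open import Data.Product using (Σ; ∃; _×_; _,_)
open import Relation.Binary.PropositionalEquality using (_≡_; _≢_)

-- Base-k expansion of n, most significant digit first, without leading
-- zeros (so the expansion of 0 is the empty word).  'fuel' bounds the
-- recursion; with fuel ≥ n the result is the true expansion.
digitsAux : (k : ℕ) → .{{_ : NonZero k}} → ℕ → ℕ → List (Fin k)
digitsAux k zero    n       = []
digitsAux k (suc f) zero    = []
digitsAux k (suc f) (suc n) =
  digitsAux k f (suc n / k) ++ (fromℕ< (m%n<n (suc n) k) ∷ [])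

digits : (k : ℕ) → .{{_ : NonZero k}} → ℕ → List (Fin k)
digits k n = digitsAux k n n

record DFAO (k : ℕ) (A : Set) : Set where
  field
    m  : ℕ
    s₀ : Fin m
    δ  : Fin m → Fin k → Fin m
    τ  : Fin m → A

δ* : ∀ {k m} → (Fin m → Fin k → Fin m) → Fin m → List (Fin k) → Fin m
δ* δ s w = foldl δ s w

IsKAutomatic : {A : Set} (k : ℕ) → .{{_ : NonZero k}} → (ℕ → A) → Set
IsKAutomatic {A} k a =
  Σ (DFAO k A) λ M →
    (n : ℕ) → a n ≡ DFAO.τ M (δ* (DFAO.δ M) (DFAO.s₀ M) (digits k n))

IsAutomatic : {A : Set} → (ℕ → A) → Set
IsAutomatic a = Σ ℕ λ j → IsKAutomatic (suc (suc j)) a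

IsWeaklyPeriodic : {A : Set} → (ℕ → A) → Set
IsWeaklyPeriodic f =
  (a b : ℕ) → 1 ≤ a →
    Σ ℕ λ q → 1 ≤ q × Σ ℕ λ r → Σ ℕ λ r' → r ≢ r' ×
      ((n : ℕ) → f (a * (q * n + r) + b) ≡ f (a * (q * n + r') + b))

module Submission where

-- Let f be generated by a k-DFAO M with m states, and fix a ≥ 1, b.  For a
-- length L and a block t < k^L, the expansion of t + k^L·c (c ≥ 1) is the
-- expansion of c followed by the L-digit zero-padded expansion of t.  Hence
-- f (t + k^L·c) depends on t only through its "behaviour": the state reached
-- from s₀ on (t)_k (needed for c = 0) together with the state transformer of
-- its padded expansion, tabulated as a vector in Vec (Fin m) (1 + m).  There
-- are at most m^(1+m) behaviours, so among the P = 1 + m^(1+m) blocks a·r + b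
-- (r < P) two, r ≠ r', behave alike (pigeonhole).  Taking L so large that all
-- these blocks are below q = k^L, the identity a(qn + r) + b = (ar + b) + q·an
-- shows f (a(qn + r) + b) = f (a(qn + r') + b) for all n.

open import Defs
open import Data.Nat using (ℕ; zero; suc; _+_; _*_; _^_; _≤_; _<_; z≤n; s≤s; s≤s⁻¹; NonZero)
open import Data.Nat.Properties
open import Data.Nat.DivMod
open import Data.Nat.Divisibility using (divides)
open import Data.Fin using (Fin; fromℕ<; toℕ; combine)
import Data.Fin.Properties as Finₚ
open import Data.List using (List; []; _∷_; _++_)
open import Data.List.Properties using (foldl-++; ++-assoc; ++-identityʳ)
open import Data.Vec using (Vec; tabulate; lookup) renaming ([] to []ᵛ; _∷_ to _∷ᵛ_)
open import Data.Vec.Properties using (lookup∘tabulate; ∷-injective)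
open import Data.Product using (_,_; proj₁; proj₂; ∃₂; _×_)
open import Relation.Binary.PropositionalEquality
open import Function using (_∘_)
open import Data.Nat.Solver using (module +-*-Solver)

encode : ∀ {m n} → Vec (Fin m) n → Fin (m ^ n)
encode []ᵛ        = Data.Fin.zero
encode (x ∷ᵛ xs) = combine x (encode xs)

encode-injective : ∀ {m n} (xs ys : Vec (Fin m) n) → encode xs ≡ encode ys → xs ≡ ys
encode-injective []ᵛ        []ᵛ        _ = refl
encode-injective (x ∷ᵛ xs) (y ∷ᵛ ys) e
  with refl , e′ ← Finₚ.combine-injective x (encode xs) y (encode ys) e
  = cong (x ∷ᵛ_) (encode-injective xs ys e′)

vec-pigeonhole : ∀ {m n} (g : Fin (suc (m ^ n)) → Vec (Fin m) n) →
                 ∃₂ λ i j → i Data.Fin.< j × g i ≡ g j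
vec-pigeonhole g with i , j , i<j , same ← Finₚ.pigeonhole (n<1+n _) (encode ∘ g)
  = i , j , i<j , encode-injective (g i) (g j) same

module Expansions (k : ℕ) .{{_ : NonZero k}} (1<k : 1 < k) where

  lastDigit : ℕ → Fin k
  lastDigit n = fromℕ< (m%n<n n k)

  digitsAux-fuel : ∀ f g n → n ≤ f → n ≤ g → digitsAux k f n ≡ digitsAux k g n
  digitsAux-fuel zero    zero    zero    _ _ = refl
  digitsAux-fuel zero    (suc g) zero    _ _ = refl
  digitsAux-fuel (suc f) zero    zero    _ _ = refl
  digitsAux-fuel (suc f) (suc g) zero    _ _ = refl
  digitsAux-fuel (suc f) (suc g) (suc n) n<f n<g =
    cong (_++ _) (digitsAux-fuel f g (suc n / k) (quotient≤ n<f) (quotient≤ n<g))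
    where
    quotient≤ : ∀ {h} → suc n ≤ suc h → suc n / k ≤ h
    quotient≤ le = s≤s⁻¹ (<-≤-trans (m/n<m (suc n) k 1<k) le)

  digits-snoc : ∀ n → 1 ≤ n → digits k n ≡ digits k (n / k) ++ (lastDigit n ∷ [])
  digits-snoc (suc n) _ =
    cong (_++ (lastDigit (suc n) ∷ [])) (digitsAux-fuel n (suc n / k) (suc n / k)
                    (s≤s⁻¹ (m/n<m (suc n) k 1<k)) ≤-refl)

  padded : ℕ → ℕ → List (Fin k)
  padded zero    t = []
  padded (suc L) t = padded L (t / k) ++ (lastDigit t ∷ [])

  n<k^n : ∀ n → n < k ^ n
  n<k^n zero    = s≤s z≤n
  n<k^n (suc n) = ≤-trans (s≤s (n<k^n n))
    (subst (k ^ n <_) (*-comm (k ^ n) k) (m<m*n (k ^ n) k {{m^n≢0 k n}} 1<k))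

  /-shift : ∀ t X → (t + X * k) / k ≡ t / k + X
  /-shift t X = trans (+-distrib-/-∣ʳ t (divides X refl)) (cong (t / k +_) (m*n/n≡m X k))

  lastDigit-shift : ∀ t X → lastDigit (t + X * k) ≡ lastDigit t
  lastDigit-shift t X = Finₚ.fromℕ<-cong _ _ ([m+kn]%n≡m%n t X k) _ _

  digits-split : ∀ L c t → 1 ≤ c → t < k ^ L →
                 digits k (t + k ^ L * c) ≡ digits k c ++ padded L t
  digits-split zero    c zero    _ _ =
    trans (cong (digits k) (+-identityʳ c)) (sym (++-identityʳ _))
  digits-split zero    c (suc t) _ (s≤s ())
  digits-split (suc L) c t 1≤c t<k^L+1 = begin
      digits k (t + k ^ suc L * c)
    ≡⟨ cong (digits k) n-def ⟩
      digits k n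
    ≡⟨ digits-snoc n 1≤n ⟩
      digits k (n / k) ++ (lastDigit n ∷ [])
    ≡⟨ cong₂ (λ x d → digits k x ++ (d ∷ [])) (/-shift t X) (lastDigit-shift t X) ⟩
      digits k (t / k + k ^ L * c) ++ (lastDigit t ∷ [])
    ≡⟨ cong (_++ _) (digits-split L c (t / k) 1≤c t/k<k^L) ⟩
      (digits k c ++ padded L (t / k)) ++ (lastDigit t ∷ [])
    ≡⟨ ++-assoc (digits k c) _ _ ⟩
      digits k c ++ padded (suc L) t
    ∎
    where
    open ≡-Reasoning
    X n : ℕ
    X = k ^ L * c
    n = t + X * k
    n-def : t + k ^ suc L * c ≡ n
    n-def = cong (t +_) (trans (*-assoc k (k ^ L) c) (*-comm k X))
    1≤n : 1 ≤ n
    1≤n = ≤-trans (*-mono-≤ (m^n>0 k L) 1≤c) (≤-trans (m≤m*n X k) (m≤n+m _ t))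
    t/k<k^L : t / k < k ^ L
    t/k<k^L = m<n*o⇒m/o<n (subst (t <_) (*-comm k (k ^ L)) t<k^L+1)

  module Runs {A : Set} (M : DFAO k A) where
    open DFAO M

    behaviour : ℕ → ℕ → Vec (Fin m) (suc m)
    behaviour L t = δ* δ s₀ (digits k t) ∷ᵛ tabulate (λ s → δ* δ s (padded L t))

    module _ (f : ℕ → A) (generates : ∀ n → f n ≡ τ (δ* δ s₀ (digits k n))) where

      read-block : ∀ L u → f (u + k ^ L * 0) ≡ τ (δ* δ s₀ (digits k u))
      read-block L u =
        trans (cong f (trans (cong (u +_) (*-zeroʳ (k ^ L))) (+-identityʳ u))) (generates u)

      read-continued : ∀ L c u → 1 ≤ c → u < k ^ L →
                       f (u + k ^ L * c) ≡ τ (δ* δ (δ* δ s₀ (digits k c)) (padded L u))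
      read-continued L c u 1≤c u<k^L = trans (generates _)
        (cong τ (trans (cong (δ* δ s₀) (digits-split L c u 1≤c u<k^L))
                       (foldl-++ δ s₀ (digits k c) (padded L u))))

      same-behaviour : ∀ L t t′ → t < k ^ L → t′ < k ^ L →
                       behaviour L t ≡ behaviour L t′ →
                       ∀ c → f (t + k ^ L * c) ≡ f (t′ + k ^ L * c)
      same-behaviour L t t′ _ _ same zero = begin
          f (t + k ^ L * 0)         ≡⟨ read-block L t ⟩
          τ (δ* δ s₀ (digits k t))  ≡⟨ cong τ (proj₁ (∷-injective same)) ⟩
          τ (δ* δ s₀ (digits k t′)) ≡⟨ sym (read-block L t′) ⟩
          f (t′ + k ^ L * 0)        ∎
        where open ≡-Reasoning
      same-behaviour L t t′ t<k^L t′<k^L same c@(suc _) = begin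
          f (t + k ^ L * c)                    ≡⟨ read-continued L c t (s≤s z≤n) t<k^L ⟩
          τ (δ* δ state (padded L t))          ≡⟨ cong τ padded-run ⟩
          τ (δ* δ state (padded L t′))         ≡⟨ sym (read-continued L c t′ (s≤s z≤n) t′<k^L) ⟩
          f (t′ + k ^ L * c)                   ∎
        where
        open ≡-Reasoning
        state : Fin m
        state = δ* δ s₀ (digits k c)
        padded-run : δ* δ state (padded L t) ≡ δ* δ state (padded L t′)
        padded-run = begin
          δ* δ state (padded L t)                             ≡⟨ sym (lookup∘tabulate _ state) ⟩
          lookup (tabulate (λ s → δ* δ s (padded L t))) state  ≡⟨ cong (λ v → lookup v state) (proj₂ (∷-injective same)) ⟩
          lookup (tabulate (λ s → δ* δ s (padded L t′))) state ≡⟨ lookup∘tabulate _ state ⟩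
          δ* δ state (padded L t′)                            ∎

regroup : ∀ a q n r b → a * (q * n + r) + b ≡ (a * r + b) + q * (a * n)
regroup = solve 5 (λ a q n r b → a :* (q :* n :+ r) :+ b := (a :* r :+ b) :+ q :* (a :* n)) refl
  where open +-*-Solver

lemma2p1 : {A : Set} (f : ℕ → A) → IsAutomatic f → IsWeaklyPeriodic f
lemma2p1 f (j , M , generates) a b _ =
  q , m^n>0 k L , toℕ r , toℕ r′ , <⇒≢ r<r′ , periodic
  where
  k : ℕ
  k = suc (suc j)
  open Expansions k (s≤s (s≤s z≤n))
  open Runs M
  open DFAO M using (m)
  -- More residues than behaviours.
  P : ℕ
  P = suc (m ^ suc m)
  -- Any L with a·(P - 1) + b < k^L works; this one is easy to bound.
  L : ℕ
  L = a * P + b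
  q : ℕ
  q = k ^ L
  block : Fin P → ℕ
  block r = a * toℕ r + b
  block<q : ∀ r → block r < q
  block<q r = <-≤-trans (s≤s (+-monoˡ-≤ b (*-monoʳ-≤ a (<⇒≤ (Finₚ.toℕ<n r))))) (n<k^n L)
  collision : ∃₂ λ r r′ → r Data.Fin.< r′ × behaviour L (block r) ≡ behaviour L (block r′)
  collision = vec-pigeonhole (λ r → behaviour L (block r))
  r r′ : Fin P
  r = proj₁ collision
  r′ = proj₁ (proj₂ collision)
  r<r′ : toℕ r < toℕ r′
  r<r′ = proj₁ (proj₂ (proj₂ collision))
  periodic : ∀ n → f (a * (q * n + toℕ r) + b) ≡ f (a * (q * n + toℕ r′) + b)
  periodic n rewrite regroup a q n (toℕ r) b | regroup a q n (toℕ r′) b =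
    same-behaviour f generates L (block r) (block r′) (block<q r) (block<q r′)
      (proj₂ (proj₂ (proj₂ collision))) (a * n)
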